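{- Let $D$ be a digraph with $\mathsf{d}_s^-(D)\ge 2$ and let $a\in A(D)$. If $D-a$ is strong, then $\mathsf{d}_s^-(D)-1\le \mathsf{d}_s^-(D-a)\le \mathsf{d}_s^-(D)$.
   Context: Digraphs are finite, loopless, without parallel arcs. A digraph is strong if for every ordered pair $u,v$ there is a directed $uv$-walk. $S\subseteq V(D)$ is in-dominating if every vertex not in $S$ has an out-neighbor in $S$; it is strong in-dominating if moreover the induced subdigraph $D\langle S\rangle$ is strong. $\mathsf{d}_s^-(D)$ is the maximum number of classes of a partition of $V(D)$ into strong in-dominating sets (defined when $D$ is strong). $D-a$ is $D$ with the arc $a$ deleted. -}

module Defs where

open import Data.Nat using (ℕ; _≤_)
open import Data.Fin using (Fin)
open import Data.Fin.Properties using (_≟_)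
open import Data.Bool using (Bool; true; false; _∧_; not)
open import Data.Product using (Σ; ∃; _×_; _,_)
open import Relation.Nullary using (¬_)
open import Relation.Nullary.Decidable using (⌊_⌋)
open import Relation.Binary.PropositionalEquality using (_≡_)
open import Function.Definitions using (Surjective)

-- A digraph on vertex set Fin n: arcs given by a Boolean adjacency relation
-- (so no parallel arcs), with no loops.
record Digraph (n : ℕ) : Set where
  field
    adj      : Fin n → Fin n → Bool
    loopless : ∀ v → adj v v ≡ false
open Digraph public

IsArc : ∀ {n} → Digraph n → Fin n → Fin n → Set
IsArc D u v = adj D u v ≡ true

deleteArc : ∀ {n} → Digraph n → Fin n → Fin n → Digraph n
deleteArc {n} D x y = record
  { adj = λ u v → adj D u v ∧ not (⌊ u ≟ x ⌋ ∧ ⌊ v ≟ y ⌋)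
  ; loopless = λ v → lem v }
  where
  open import Relation.Binary.PropositionalEquality using (cong)
  lem : ∀ v → (adj D v v ∧ not (⌊ v ≟ x ⌋ ∧ ⌊ v ≟ y ⌋)) ≡ false
  lem v with adj D v v | loopless D v
  ... | false | _ = Relation.Binary.PropositionalEquality.refl

-- Directed walk from u to v in D using only vertices satisfying P
-- (i.e. a walk in the induced subdigraph D⟨P⟩).
data Walk {n} (D : Digraph n) (P : Fin n → Set) : Fin n → Fin n → Set where
  here : ∀ {u} → P u → Walk D P u u
  step : ∀ {u w v} → P u → IsArc D u w → Walk D P w v → Walk D P u v

InducedStrong : ∀ {n} → Digraph n → (Fin n → Set) → Set
InducedStrong D S = ∀ u v → S u → S v → Walk D S u v

Strong : ∀ {n} → Digraph n → Set
Strong D = InducedStrong D (λ _ → Data.Unit.⊤)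
  where import Data.Unit

InDominating : ∀ {n} → Digraph n → (Fin n → Set) → Set
InDominating D S = ∀ v → ¬ S v → ∃ λ w → S w × IsArc D v w

StrongInDominating : ∀ {n} → Digraph n → (Fin n → Set) → Set
StrongInDominating D S = InDominating D S × InducedStrong D S

-- A partition of V(D) into k (nonempty) classes, given by a surjective class
-- map c : Fin n → Fin k (class i = c⁻¹(i)), all classes strong in-dominating.
StrongInDomPartition : ∀ {n} → Digraph n → ℕ → Set
StrongInDomPartition {n} D k =
  Σ (Fin n → Fin k) λ c →
    Surjective _≡_ _≡_ c × (∀ i → StrongInDominating D (λ v → c v ≡ i))

IsDsMinus : ∀ {n} → Digraph n → ℕ → Set
IsDsMinus D k = StrongInDomPartition D k × (∀ m → StrongInDomPartition D m → m ≤ k)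

-- Fix an optimal partition of D into strong in-dominating classes and delete the arc xy. Every
-- class other than the class Y of y survives in D − xy. Y can only stop being in-dominating if
-- x ∉ Y and y was the only out-neighbour of x in Y, and only stop being strong if x ∈ Y and no
-- x–y walk inside Y avoids xy. When Y does break, an x–y walk in the strong digraph D − xy yields
-- a class Q ≠ Y with Y ∪ Q strong in D − xy: the class of the vertex from which the walk enters Y
-- for the last time if x ∈ Y, and the class of the vertex following x otherwise. Since the union
-- of two classes is always in-dominating in D − xy, merging Y and Q leaves k − 1 classes. The
-- upper bound holds because a partition of D − xy is also one of D.
module Submission where

open import Defs
open import Data.Nat using (ℕ; suc; _≤_; _∸_; s≤s)
open import Data.Nat.Properties using (≤-trans; n≤1+n)
open import Data.Fin using (Fin; punchIn; punchOut)
open import Data.Fin.Properties using (_≟_; punchInᵢ≢i; punchOut-cong; punchOut-punchIn; punchIn-punchOut)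
open import Data.Bool.Properties using (∧-conicalˡ)
open import Data.Product using (_×_; ∃; ∃₂; _,_; proj₁; proj₂)
open import Data.Sum using (_⊎_; inj₁; inj₂)
open import Data.Unit using (⊤; tt)
open import Level using (0ℓ)
open import Relation.Nullary using (¬_; Dec; yes; no; contradiction)
open import Relation.Unary using (Pred; Decidable; _⊆_; _∪_; _≐_)
open import Relation.Binary.PropositionalEquality
open import Function using (id; _∘_)
open import Function.Definitions using (Surjective)

private
  variable
    n : ℕ

module _ {D : Digraph n} where

  walk-start : ∀ {P u v} → Walk D P u v → P u
  walk-start (here p)     = p
  walk-start (step p _ _) = p

  infixr 5 _++ʷ_
  _++ʷ_ : ∀ {P u v w} → Walk D P u v → Walk D P v w → Walk D P u w
  here _     ++ʷ q = q
  step p a r ++ʷ q = step p a (r ++ʷ q)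

  walk-firstArc : ∀ {P u v} → Walk D P u v → u ≢ v → ∃ (IsArc D u)
  walk-firstArc (here _)              u≢u = contradiction refl u≢u
  walk-firstArc (step {w = w} _ a _) _   = w , a

  walk-lastEntry : ∀ {P S : Pred (Fin n) 0ℓ} {u v} → Decidable S → S v → Walk D P u v →
                   Walk D S u v ⊎ ∃₂ λ s t → ¬ S s × IsArc D s t × Walk D S t v
  walk-lastEntry S? sv (here _) = inj₁ (here sv)
  walk-lastEntry S? sv (step {u} {w} _ a r) with walk-lastEntry S? sv r
  ... | inj₂ entry = inj₂ entry
  ... | inj₁ r′ with S? u
  ...   | yes su = inj₁ (step su a r′)
  ...   | no ¬su = inj₂ (u , w , ¬su , a , r′)

module _ {D D′ : Digraph n} {P Q : Pred (Fin n) 0ℓ} where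

  walk-map : P ⊆ Q → (∀ {u w} → P u → P w → IsArc D u w → Walk D′ Q u w) →
             ∀ {u v} → Walk D P u v → Walk D′ Q u v
  walk-map P⊆Q f (here p)     = here (P⊆Q p)
  walk-map P⊆Q f (step p a r) = f p (walk-start r) a ++ʷ walk-map P⊆Q f r

walk-mono : ∀ {D : Digraph n} {P Q} → P ⊆ Q → ∀ {u v} → Walk D P u v → Walk D Q u v
walk-mono P⊆Q = walk-map P⊆Q (λ pu pw a → step (P⊆Q pu) a (here (P⊆Q pw)))

_⊆ᵃ_ : Digraph n → Digraph n → Set
D′ ⊆ᵃ D = ∀ {u w} → IsArc D′ u w → IsArc D u w

module _ {D : Digraph n} where

  StrongInDominating-≐ : ∀ {P Q} → P ≐ Q → StrongInDominating D P → StrongInDominating D Q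
  StrongInDominating-≐ (P⊆Q , Q⊆P) (dom , str) =
    (λ v ¬qv → let (w , pw , a) = dom v (¬qv ∘ P⊆Q) in w , P⊆Q pw , a) ,
    (λ u v qu qv → walk-mono P⊆Q (str u v (Q⊆P qu) (Q⊆P qv)))

  InducedStrong-∪ : ∀ {P Q} →
    (∀ u v → P u → P v → Walk D (P ∪ Q) u v) →
    (∀ u v → Q u → Q v → Walk D (P ∪ Q) u v) →
    (∀ u → P u → ∃ λ s → Q s × Walk D (P ∪ Q) u s) →
    (∀ u → Q u → ∃ λ s → P s × Walk D (P ∪ Q) u s) →
    InducedStrong D (P ∪ Q)
  InducedStrong-∪ strP strQ P→Q Q→P u v (inj₁ pu) (inj₁ pv) = strP u v pu pv
  InducedStrong-∪ strP strQ P→Q Q→P u v (inj₂ qu) (inj₂ qv) = strQ u v qu qv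
  InducedStrong-∪ strP strQ P→Q Q→P u v (inj₁ pu) (inj₂ qv) =
    let (s , qs , W) = P→Q u pu in W ++ʷ strQ s v qs qv
  InducedStrong-∪ strP strQ P→Q Q→P u v (inj₂ qu) (inj₁ pv) =
    let (s , ps , W) = Q→P u qu in W ++ʷ strP s v ps pv

StrongInDomPartition-⊆ᵃ : ∀ {D′ D : Digraph n} {k} → D′ ⊆ᵃ D →
                          StrongInDomPartition D′ k → StrongInDomPartition D k
StrongInDomPartition-⊆ᵃ D′⊆D (c , surj , sid) = c , surj , λ i →
  (λ v ¬cv → let (w , cw , a) = proj₁ (sid i) v ¬cv in w , cw , D′⊆D a) ,
  (λ u v cu cv → walk-map id (λ cu cw a → step cu (D′⊆D a) (here cw)) (proj₂ (sid i) u v cu cv))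

fibre : ∀ {k} → (Fin n → Fin k) → Fin k → Pred (Fin n) 0ℓ
fibre c r v = c v ≡ r

module _ {m} {p q : Fin (suc m)} (p≢q : p ≢ q) where

  -- Class q is merged into class p, and the other classes are renumbered by punching out q.
  mergeInto : Fin (suc m) → Fin m
  mergeInto s with s ≟ q
  ... | yes _   = punchOut (p≢q ∘ sym)
  ... | no s≢q = punchOut (s≢q ∘ sym)

  mergeInto-punchIn : ∀ t → mergeInto (punchIn q t) ≡ t
  mergeInto-punchIn t with punchIn q t ≟ q
  ... | yes eq = contradiction eq (punchInᵢ≢i q t)
  ... | no _   = trans (punchOut-cong q refl) (punchOut-punchIn q)

  mergeInto-target : ∀ t → p ≡ punchIn q t → mergeInto q ≡ t
  mergeInto-target t p≡ with q ≟ q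
  ... | yes _   = trans (punchOut-cong q p≡) (punchOut-punchIn q)
  ... | no q≢q = contradiction refl q≢q

  mergeInto-fibre : ∀ s t → mergeInto s ≡ t → s ≡ q × p ≡ punchIn q t ⊎ s ≡ punchIn q t
  mergeInto-fibre s t eq with s ≟ q
  ... | yes s≡q = inj₁ (s≡q , trans (sym (punchIn-punchOut _)) (cong (punchIn q) eq))
  ... | no _    = inj₂ (trans (sym (punchIn-punchOut _)) (cong (punchIn q) eq))

partition-merge : ∀ {n} {D : Digraph n} {m} (c : Fin n → Fin (suc m)) → Surjective _≡_ _≡_ c →
  ∀ {p q} → p ≢ q → StrongInDominating D (fibre c p ∪ fibre c q) →
  (∀ r → r ≢ p → r ≢ q → StrongInDominating D (fibre c r)) → StrongInDomPartition D m
partition-merge {n} {D} {m} c surj {p} {q} p≢q sidPQ sidOther = merged , merged-surj , merged-sid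
  where
  merged : Fin n → Fin m
  merged = mergeInto p≢q ∘ c

  merged-surj : Surjective _≡_ _≡_ merged
  merged-surj t = let (v , cv) = surj (punchIn q t) in
    v , λ cz → trans (cong (mergeInto p≢q) (cv cz)) (mergeInto-punchIn p≢q t)

  merged-sid : ∀ t → StrongInDominating D (fibre merged t)
  merged-sid t with p ≟ punchIn q t
  ... | yes p≡ = StrongInDominating-≐ (into , back) sidPQ
    where
    into : fibre c p ∪ fibre c q ⊆ fibre merged t
    into (inj₁ cv≡p) = trans (cong (mergeInto p≢q) (trans cv≡p p≡)) (mergeInto-punchIn p≢q t)
    into (inj₂ cv≡q) = trans (cong (mergeInto p≢q) cv≡q) (mergeInto-target p≢q t p≡)
    back : fibre merged t ⊆ fibre c p ∪ fibre c q
    back {v} eq with mergeInto-fibre p≢q (c v) t eq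
    ... | inj₁ (cv≡q , _) = inj₂ cv≡q
    ... | inj₂ cv≡        = inj₁ (trans cv≡ (sym p≡))
  ... | no p≢ = StrongInDominating-≐ (into , back)
                  (sidOther (punchIn q t) (p≢ ∘ sym) (punchInᵢ≢i q t))
    where
    into : fibre c (punchIn q t) ⊆ fibre merged t
    into cv≡ = trans (cong (mergeInto p≢q) cv≡) (mergeInto-punchIn p≢q t)
    back : fibre merged t ⊆ fibre c (punchIn q t)
    back {v} eq with mergeInto-fibre p≢q (c v) t eq
    ... | inj₁ (_ , p≡) = contradiction p≡ p≢
    ... | inj₂ cv≡      = cv≡

IsArc⇒≢ : ∀ (D : Digraph n) {u w} → IsArc D u w → u ≢ w
IsArc⇒≢ D {u} a refl with trans (sym a) (loopless D u)
... | ()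

module _ (D : Digraph n) (x y : Fin n) where

  private
    D′ : Digraph n
    D′ = deleteArc D x y

  deleteArc-⊆ᵃ : D′ ⊆ᵃ D
  deleteArc-⊆ᵃ a = ∧-conicalˡ _ _ a

  deleteArc-keeps : ∀ {u w} → IsArc D u w → ¬ (u ≡ x × w ≡ y) → IsArc D′ u w
  deleteArc-keeps {u} {w} a ¬xy with u ≟ x | w ≟ y
  ... | yes u≡x | yes w≡y = contradiction (u≡x , w≡y) ¬xy
  ... | yes _   | no _    rewrite a = refl
  ... | no _    | _       rewrite a = refl

  walk-deleteArc : ∀ {S U : Pred (Fin n) 0ℓ} → S ⊆ U → (S x → S y → Walk D′ U x y) →
                   ∀ {u v} → Walk D S u v → Walk D′ U u v
  walk-deleteArc {S} {U} S⊆U bypass = walk-map S⊆U replace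
    where
    replace : ∀ {u w} → S u → S w → IsArc D u w → Walk D′ U u w
    replace {u} {w} su sw a with u ≟ x | w ≟ y
    ... | yes refl | yes refl = bypass su sw
    ... | yes _    | no w≢y   = step (S⊆U su) (deleteArc-keeps a (w≢y ∘ proj₂)) (here (S⊆U sw))
    ... | no u≢x   | _        = step (S⊆U su) (deleteArc-keeps a (u≢x ∘ proj₁)) (here (S⊆U sw))

  outArc-deleteArc : ∀ {T : Pred (Fin n) 0ℓ} {u} → InDominating D T → ¬ T u → u ≢ x ⊎ ¬ T y →
                     ∃ λ t → T t × IsArc D′ u t
  outArc-deleteArc {T} dom ¬tu avoid =
    let (t , t∈T , a) = dom _ ¬tu in t , t∈T , deleteArc-keeps a (not-xy avoid t∈T)
    where
    not-xy : ∀ {u t} → u ≢ x ⊎ ¬ T y → T t → ¬ (u ≡ x × t ≡ y)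
    not-xy (inj₁ u≢x) _   (u≡x , _)  = u≢x u≡x
    not-xy (inj₂ ¬ty) t∈T (_ , refl) = ¬ty t∈T

  StrongInDominating-deleteArc : ∀ {S} → StrongInDominating D S →
    (S x → S y → Walk D′ S x y) → (S y → ¬ S x → ∃ λ w → S w × IsArc D′ x w) →
    StrongInDominating D′ S
  StrongInDominating-deleteArc {S} (dom , str) bypass reroute = dom′ , str′
    where
    dom′ : InDominating D′ S
    dom′ v ¬sv = let (t , st , a) = dom v ¬sv in redirect st ¬sv a (v ≟ x) (t ≟ y)
      where
      redirect : ∀ {v t} → S t → ¬ S v → IsArc D v t → Dec (v ≡ x) → Dec (t ≡ y) →
                 ∃ λ w → S w × IsArc D′ v w
      redirect st ¬sv a (yes refl) (yes refl) = reroute st ¬sv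
      redirect st _   a (yes _)    (no t≢y)   = _ , st , deleteArc-keeps a (t≢y ∘ proj₂)
      redirect st _   a (no v≢x)   _          = _ , st , deleteArc-keeps a (v≢x ∘ proj₁)
    str′ : InducedStrong D′ S
    str′ u v su sv = walk-deleteArc id bypass (str u v su sv)

  ∪-InDominating-deleteArc : ∀ {S T : Pred (Fin n) 0ℓ} → InDominating D S → InDominating D T →
                             (∀ {v} → S v → ¬ T v) → InDominating D′ (S ∪ T)
  ∪-InDominating-deleteArc domS domT disjoint v ¬s∪t
    with domS v (¬s∪t ∘ inj₁) | domT v (¬s∪t ∘ inj₂)
  ... | s , s∈S , vs | t , t∈T , vt with s ≟ y
  ... | no s≢y   = s , inj₁ s∈S , deleteArc-keeps vs (s≢y ∘ proj₂)
  ... | yes refl = t , inj₂ t∈T , deleteArc-keeps vt (λ { (_ , refl) → disjoint s∈S t∈T })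

  module _ {m} (c : Fin n → Fin (suc m)) (surj : Surjective _≡_ _≡_ c)
           (sid : ∀ r → StrongInDominating D (fibre c r)) where

    private
      Y : Pred (Fin n) 0ℓ
      Y = fibre c (c y)

      fibre-walk : ∀ {r U} → fibre c r ⊆ U → (c x ≡ r → c y ≡ r → Walk D′ U x y) →
                   ∀ u v → c u ≡ r → c v ≡ r → Walk D′ U u v
      fibre-walk {r} ⊆U bypass u v cu cv = walk-deleteArc ⊆U bypass (proj₂ (sid r) u v cu cv)

      exit : ∀ {r} u → c u ≢ r → u ≢ x ⊎ c y ≢ r → ∃ λ t → c t ≡ r × IsArc D′ u t
      exit {r} u cu≢r = outArc-deleteArc (proj₁ (sid r)) cu≢r

    partition-survives : (c x ≡ c y → Walk D′ Y x y) →
                         (c x ≢ c y → ∃ λ w → c w ≡ c y × IsArc D′ x w) →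
                         StrongInDomPartition D′ (suc m)
    partition-survives bypass reroute = c , surj , λ r →
      StrongInDominating-deleteArc (sid r)
        (λ cx≡r cy≡r → subst (λ r → Walk D′ (fibre c r) x y) cy≡r (bypass (trans cx≡r (sym cy≡r))))
        (λ cy≡r cx≢r → let (w , cw , a) = reroute (λ cx≡cy → cx≢r (trans cx≡cy cy≡r))
                       in w , trans cw cy≡r , a)

    partition-mergeWithY : ∀ {q} → q ≢ c y → InducedStrong D′ (Y ∪ fibre c q) →
                           StrongInDomPartition D′ m
    partition-mergeWithY {q} q≢cy str = partition-merge c surj (q≢cy ∘ sym)
      (∪-InDominating-deleteArc (proj₁ (sid (c y))) (proj₁ (sid q))
         (λ cv≡cy cv≡q → q≢cy (trans (sym cv≡q) cv≡cy)) , str)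
      (λ r r≢cy _ → StrongInDominating-deleteArc (sid r)
        (λ _ cy≡r → contradiction (sym cy≡r) r≢cy) (λ cy≡r _ → contradiction (sym cy≡r) r≢cy))

    ∪-strong-lastEntry : ∀ {v w} → c x ≡ c y → c v ≢ c y → IsArc D′ v w → Walk D′ Y w y →
                         InducedStrong D′ (Y ∪ fibre c (c v))
    ∪-strong-lastEntry {v} {w} cx≡cy cv≢cy vw wy =
      InducedStrong-∪ (fibre-walk inj₁ (λ _ _ → bypass)) strQ Y→Q Q→Y
      where
      strQ : ∀ u u′ → c u ≡ c v → c u′ ≡ c v → Walk D′ (Y ∪ fibre c (c v)) u u′
      strQ = fibre-walk inj₂ (λ cx≡cv _ → contradiction (trans (sym cx≡cv) cx≡cy) cv≢cy)
      Q→Y : ∀ u → c u ≡ c v → ∃ λ s → Y s × Walk D′ (Y ∪ fibre c (c v)) u s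
      Q→Y u cu = w , walk-start wy ,
                 strQ u v cu refl ++ʷ step (inj₂ refl) vw (here (inj₁ (walk-start wy)))
      Y→Q : ∀ u → Y u → ∃ λ s → c s ≡ c v × Walk D′ (Y ∪ fibre c (c v)) u s
      Y→Q u cu = let (t , ct , a) = exit u (λ cu≡cv → cv≢cy (trans (sym cu≡cv) cu))
                                            (inj₂ (cv≢cy ∘ sym))
                 in t , ct , step (inj₁ cu) a (here (inj₂ ct))
      bypass : Walk D′ (Y ∪ fibre c (c v)) x y
      bypass = let (t , ct , W) = Y→Q x cx≡cy
               in W ++ʷ strQ t v ct refl ++ʷ step (inj₂ refl) vw (walk-mono inj₁ wy)

    ∪-strong-firstArc : ∀ {w} → c x ≢ c y → c w ≢ c y → IsArc D′ x w →
                        InducedStrong D′ (Y ∪ fibre c (c w))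
    ∪-strong-firstArc {w} cx≢cy cw≢cy xw = InducedStrong-∪
      (fibre-walk inj₁ (λ cx≡cy _ → contradiction cx≡cy cx≢cy))
      (fibre-walk inj₂ (λ _ cy≡cw → contradiction (sym cy≡cw) cw≢cy))
      Y→Q Q→Y
      where
      Y→Q : ∀ u → Y u → ∃ λ s → c s ≡ c w × Walk D′ (Y ∪ fibre c (c w)) u s
      Y→Q u cu = let (t , ct , a) = exit u (λ cu≡cw → cw≢cy (trans (sym cu≡cw) cu))
                                            (inj₁ (λ { refl → cx≢cy cu }))
                 in t , ct , step (inj₁ cu) a (here (inj₂ ct))
      Q→Y-direct : ∀ u → c u ≡ c w → u ≢ x → ∃ λ s → Y s × Walk D′ (Y ∪ fibre c (c w)) u s
      Q→Y-direct u cu u≢x =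
        let (t , ct , a) = exit u (λ cu≡cy → cw≢cy (trans (sym cu) cu≡cy)) (inj₁ u≢x)
        in t , ct , step (inj₂ cu) a (here (inj₁ ct))
      Q→Y : ∀ u → c u ≡ c w → ∃ λ s → Y s × Walk D′ (Y ∪ fibre c (c w)) u s
      Q→Y u cu with u ≟ x
      ... | no u≢x  = Q→Y-direct u cu u≢x
      ... | yes refl = let (s , ys , W) = Q→Y-direct w refl (IsArc⇒≢ D′ xw ∘ sym)
                       in s , ys , step (inj₂ cu) xw W

    partition-deleteArc : IsArc D x y → Walk D′ (λ _ → ⊤) x y →
                          StrongInDomPartition D′ (suc m) ⊎ StrongInDomPartition D′ m
    partition-deleteArc xy W with c x ≟ c y
    ... | yes cx≡cy with walk-lastEntry (λ v → c v ≟ c y) refl W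
    ...   | inj₁ W′ = inj₁ (partition-survives (λ _ → W′) (contradiction cx≡cy))
    ...   | inj₂ (v , w , cv≢cy , vw , wy) =
      inj₂ (partition-mergeWithY cv≢cy (∪-strong-lastEntry cx≡cy cv≢cy vw wy))
    partition-deleteArc xy W | no cx≢cy with walk-firstArc W (IsArc⇒≢ D xy)
    ... | w , xw with c w ≟ c y
    ...   | yes cw≡cy =
      inj₁ (partition-survives (λ cx≡cy → contradiction cx≡cy cx≢cy) (λ _ → w , cw≡cy , xw))
    ...   | no cw≢cy  = inj₂ (partition-mergeWithY cw≢cy (∪-strong-firstArc cx≢cy cw≢cy xw))

proposition5 : ∀ {n} (D : Digraph n) (x y : Fin n) (k k′ : ℕ) →
    Strong D → IsDsMinus D k → 2 ≤ k → IsArc D x y →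
    Strong (deleteArc D x y) → IsDsMinus (deleteArc D x y) k′ →
    (k ∸ 1 ≤ k′) × (k′ ≤ k)
proposition5 D x y (suc m) k′ _ ((c , surj , sid) , maxD) (s≤s _) xy strongD′ (partitionD′ , maxD′) =
  lowerBound (partition-deleteArc D x y c surj sid xy (strongD′ x y tt tt)) ,
  maxD k′ (StrongInDomPartition-⊆ᵃ (deleteArc-⊆ᵃ D x y) partitionD′)
  where
  lowerBound : StrongInDomPartition (deleteArc D x y) (suc m) ⊎
               StrongInDomPartition (deleteArc D x y) m → m ≤ k′
  lowerBound (inj₁ partition) = ≤-trans (n≤1+n m) (maxD′ (suc m) partition)
  lowerBound (inj₂ partition) = maxD′ m partition
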